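{- Given a $\Pi$-program $\Lambda$ of $\mathrm{GGMSC}$ of size $n$, there exists an equivalent program of $\mathrm{GGMSC}$ in strong negation normal form of size $\mathcal{O}(n)$.
   Context: Fix a set $\Pi$ of proposition symbols and a finite set $\mathcal{T}=\{X_1,\dots,X_k\}$ of schema variables. $(\Pi,\mathcal{T})$-schemata of $\mathrm{GGMSC}$ are given by $\varphi ::= \bot \mid \top \mid p \mid X \mid \neg\varphi \mid \varphi\lor\varphi \mid \varphi\land\varphi \mid \Diamond_{\geq k}\varphi \mid \Box_{<k}\varphi \mid \langle E\rangle_{\geq k}\varphi \mid [E]_{<k}\varphi$ with $k\in\mathbb{Z}_+$, $p\in\Pi$, $X\in\mathcal{T}$; without schema variables these are the $\Pi$-formulae of $\mathrm{GGML}$. Over a Kripke model $M=(W,R,V)$: $M,w\models\Diamond_{\geq k}\varphi$ iff at least $k$ $R$-successors of $w$ satisfy $\varphi$; $M,w\models\Box_{<k}\varphi$ iff fewer than $k$ $R$-successors of $w$ falsify $\varphi$; $\langle E\rangle_{\geq k}$, $[E]_{<k}$ are the same but counting over all of $W$. A $(\Pi,\mathcal{T})$-program $\Lambda$ of $\mathrm{GGMSC}$ consists, for each $X_i$, of a base rule $X_i(0) :- \varphi_i$ ($\varphi_i$ a $\mathrm{GGML}$-formula) and an induction rule $X_i :- \psi_i$ ($\psi_i$ a schema), plus a set of accepting predicates $\mathcal{A}\subseteq\mathcal{T}$. Define $X_i^0:=\varphi_i$ and $X_i^{n+1}$ as $\psi_i$ with each $X_j$ replaced by $X_j^n$; $M,w\models\Lambda$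 iff $M,w\models X^n$ for some $n\in\mathbb{N}$ and accepting $X$. Two programs are equivalent if they accept the same pointed models. The size of a program is the number of occurrences of proposition symbols, schema variables, negations, $\lor$ and $\land$, plus the counting thresholds $k$ of all diamonds and boxes. A program is in strong negation normal form if the only negated subschemata are negated proposition symbols. -}

module Defs where

open import Data.Nat using (ℕ; zero; suc; _+_; _*_; _≤_)
open import Data.Fin using (Fin; zero; suc)
open import Data.Bool using (Bool; true; false)
open import Data.Empty using (⊥)
open import Data.Unit using (⊤)
open import Data.Product using (Σ; _×_; _,_)
open import Data.Sum using (_⊎_)
open import Relation.Nullary using (¬_)
open import Relation.Binary.PropositionalEquality using (_≡_)
open import Function.Definitions using (Injective)

-- Syntax.  Schemata over proposition symbols Π and schema variables V.
-- Counting thresholds k ∈ ℤ₊ are encoded as  suc k  with k : ℕ, i.e. the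
-- constructor  ◇≥ k φ  denotes  ◇_{≥ (k+1)} φ, etc.

data Schema (Π : Set) (V : Set) : Set where
  `⊥ `⊤   : Schema Π V
  prop    : Π → Schema Π V
  var     : V → Schema Π V
  `¬      : Schema Π V → Schema Π V
  _`∨_ _`∧_ : Schema Π V → Schema Π V → Schema Π V
  ◇≥ □< ⟨E⟩≥ [E]< : ℕ → Schema Π V → Schema Π V

Formula : Set → Set
Formula Π = Schema Π (Fin 0)

thr : ℕ → ℕ
thr k = suc k

subst : ∀ {Π V} → (V → Formula Π) → Schema Π V → Formula Π
subst σ `⊥ = `⊥
subst σ `⊤ = `⊤
subst σ (prop p) = prop p
subst σ (var x) = σ x
subst σ (`¬ φ) = `¬ (subst σ φ)
subst σ (φ `∨ ψ) = subst σ φ `∨ subst σ ψ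
subst σ (φ `∧ ψ) = subst σ φ `∧ subst σ ψ
subst σ (◇≥ k φ) = ◇≥ k (subst σ φ)
subst σ (□< k φ) = □< k (subst σ φ)
subst σ (⟨E⟩≥ k φ) = ⟨E⟩≥ k (subst σ φ)
subst σ ([E]< k φ) = [E]< k (subst σ φ)

record Kripke (Π : Set) : Set₁ where
  field
    W : Set
    R : W → W → Set
    V : Π → W → Set

AtLeast : {W : Set} → ℕ → (W → Set) → Set
AtLeast {W} n P = Σ (Fin n → W) λ f → Injective _≡_ _≡_ f × (∀ i → P (f i))

module _ {Π : Set} (M : Kripke Π) where
  open Kripke M

  _⊨_ : W → Formula Π → Set
  w ⊨ `⊥ = ⊥
  w ⊨ `⊤ = ⊤
  w ⊨ prop p = V p w
  w ⊨ var ()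
  w ⊨ `¬ φ = ¬ (w ⊨ φ)
  w ⊨ (φ `∨ ψ) = (w ⊨ φ) ⊎ (w ⊨ ψ)
  w ⊨ (φ `∧ ψ) = (w ⊨ φ) × (w ⊨ ψ)
  w ⊨ ◇≥ k φ = AtLeast (thr k) (λ v → R w v × (v ⊨ φ))
  w ⊨ □< k φ = ¬ AtLeast (thr k) (λ v → R w v × ¬ (v ⊨ φ))
  w ⊨ ⟨E⟩≥ k φ = AtLeast (thr k) (λ v → v ⊨ φ)
  w ⊨ [E]< k φ = ¬ AtLeast (thr k) (λ v → ¬ (v ⊨ φ))

record Program (Π : Set) (t : ℕ) : Set where
  field
    base      : Fin t → Formula Π
    induction : Fin t → Schema Π (Fin t)
    accepting : Fin t → Bool

module _ {Π : Set} {t : ℕ} (Λ : Program Π t) where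
  open Program Λ

  iter : ℕ → Fin t → Formula Π
  iter zero i = base i
  iter (suc n) i = subst (iter n) (induction i)

  Accepts : (M : Kripke Π) → Kripke.W M → Set
  Accepts M w = Σ ℕ λ n → Σ (Fin t) λ i → accepting i ≡ true × _⊨_ M w (iter n i)

Equivalent : {Π : Set} {t t' : ℕ} → Program Π t → Program Π t' → Set₁
Equivalent {Π} Λ Λ' = (M : Kripke Π) (w : Kripke.W M) →
  (Accepts Λ M w → Accepts Λ' M w) × (Accepts Λ' M w → Accepts Λ M w)

size : ∀ {Π V} → Schema Π V → ℕ
size `⊥ = 0
size `⊤ = 0
size (prop _) = 1
size (var _) = 1
size (`¬ φ) = suc (size φ)
size (φ `∨ ψ) = suc (size φ + size ψ)
size (φ `∧ ψ) = suc (size φ + size ψ)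
size (◇≥ k φ) = thr k + size φ
size (□< k φ) = thr k + size φ
size (⟨E⟩≥ k φ) = thr k + size φ
size ([E]< k φ) = thr k + size φ

sumFin : (t : ℕ) → (Fin t → ℕ) → ℕ
sumFin zero f = 0
sumFin (suc t) f = f zero + sumFin t (λ i → f (suc i))

programSize : ∀ {Π t} → Program Π t → ℕ
programSize {t = t} Λ =
  sumFin t (λ i → size (Program.base Λ i) + size (Program.induction Λ i))

data SNNF {Π V : Set} : Schema Π V → Set where
  `⊥ : SNNF `⊥
  `⊤ : SNNF `⊤
  prop : ∀ p → SNNF (prop p)
  var : ∀ x → SNNF (var x)
  ¬prop : ∀ p → SNNF (`¬ (prop p))
  _`∨_ : ∀ {φ ψ} → SNNF φ → SNNF ψ → SNNF (φ `∨ ψ)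
  _`∧_ : ∀ {φ ψ} → SNNF φ → SNNF ψ → SNNF (φ `∧ ψ)
  ◇≥ : ∀ {φ} k → SNNF φ → SNNF (◇≥ k φ)
  □< : ∀ {φ} k → SNNF φ → SNNF (□< k φ)
  ⟨E⟩≥ : ∀ {φ} k → SNNF φ → SNNF (⟨E⟩≥ k φ)
  [E]< : ∀ {φ} k → SNNF φ → SNNF ([E]< k φ)

ProgramSNNF : ∀ {Π t} → Program Π t → Set
ProgramSNNF Λ = (∀ i → SNNF (Program.base Λ i)) × (∀ i → SNNF (Program.induction Λ i))

-- Negations are pushed to the proposition symbols by the usual dualities
-- (¬◇≥k ↔ □<k¬, ¬⟨E⟩≥k ↔ [E]<k¬, de Morgan, ¬¬ elimination), which at most
-- double the size of a schema.  The only obstacle is a negated schema variable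
-- ¬X, which is not a proposition symbol; it is removed by adding, for every
-- X_i, a fresh variable X_i⁻ whose rules are the normal forms of the negated
-- rules of X_i.  By induction on n, X_i⁻ⁿ is equivalent to ¬X_iⁿ, so the
-- doubled program is equivalent and at most 4 times as large.
module Submission where

open import Defs
open import Level using (0ℓ)
open import Axiom.ExcludedMiddle using (ExcludedMiddle)
open import Axiom.DoubleNegationElimination using (DoubleNegationElimination; em⇒dne)
open import Data.Nat using (ℕ; zero; suc; _+_; _*_; _≤_; z≤n; s≤s)
open import Data.Nat.Properties
  using (≤-trans; ≤-reflexive; +-mono-≤; +-monoʳ-≤; +-monoˡ-≤; +-assoc; m≤m+n; n≤1+n; *-monoʳ-≤; *-zeroʳ; *-distribˡ-+; *-distribʳ-+)
open import Data.Fin using (Fin; zero; suc; _↑ˡ_; _↑ʳ_; splitAt)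
open import Data.Fin.Properties using (splitAt-↑ˡ; splitAt-↑ʳ)
open import Data.Bool using (true; false)
open import Data.Empty using (⊥-elim)
open import Data.Unit using (tt)
open import Data.Product using (Σ; _×_; _,_)
open import Data.Product.Function.NonDependent.Propositional using (_×-⇔_)
open import Data.Sum using (_⊎_; inj₁; inj₂; [_,_]′; map₁)
open import Data.Sum.Function.Propositional using (_⊎-⇔_)
open import Function using (_∘_; const)
open import Function.Bundles using (_⇔_; mk⇔; Equivalence)
open import Function.Construct.Identity using (⇔-id)
open import Function.Construct.Symmetry using (⇔-sym)
open import Function.Construct.Composition using () renaming (equivalence to ⇔-trans)
open import Function.Related.TypeIsomorphisms using (¬-cong-⇔)
open import Relation.Nullary using (¬_)
open import Relation.Binary.PropositionalEquality as ≡ using (_≡_; refl)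

open Equivalence using (to; from)

private
  variable
    A B : Set

AtLeast-cong : ∀ {W : Set} {P Q : W → Set} k → (∀ w → P w ⇔ Q w) → AtLeast k P ⇔ AtLeast k Q
AtLeast-cong k P⇔Q = mk⇔
  (λ (f , f-inj , Pf) → f , f-inj , λ i → to (P⇔Q (f i)) (Pf i))
  (λ (f , f-inj , Qf) → f , f-inj , λ i → from (P⇔Q (f i)) (Qf i))

¬-⊎-⇔ : (¬ (A ⊎ B)) ⇔ (¬ A × ¬ B)
¬-⊎-⇔ = mk⇔ (λ ¬a⊎b → ¬a⊎b ∘ inj₁ , ¬a⊎b ∘ inj₂) (λ (¬a , ¬b) → [ ¬a , ¬b ]′)

module Classical (dne : DoubleNegationElimination 0ℓ) where

  ¬¬-⇔ : (¬ ¬ A) ⇔ A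
  ¬¬-⇔ = mk⇔ dne (λ a ¬a → ¬a a)

  ¬-×-⇔ : (¬ (A × B)) ⇔ (¬ A ⊎ ¬ B)
  ¬-×-⇔ = mk⇔
    (λ ¬a×b → dne λ ¬[¬a⊎¬b] → ¬[¬a⊎¬b] (inj₁ λ a → ¬[¬a⊎¬b] (inj₂ λ b → ¬a×b (a , b))))
    (λ { (inj₁ ¬a) (a , _) → ¬a a ; (inj₂ ¬b) (_ , b) → ¬b b })

+-mono-≤-double : ∀ a b {x y} → x ≤ 2 * a → y ≤ 2 * b → x + y ≤ 2 * (a + b)
+-mono-≤-double a b x≤ y≤ = ≤-trans (+-mono-≤ x≤ y≤) (≤-reflexive (≡.sym (*-distribˡ-+ 2 a b)))

+-monoʳ-≤-double : ∀ c a {x} → x ≤ 2 * a → c + x ≤ 2 * (c + a)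
+-monoʳ-≤-double c a x≤ = ≤-trans (+-monoʳ-≤ c x≤)
  (≤-trans (+-monoˡ-≤ (2 * a) (m≤m+n c (c + 0))) (≤-reflexive (≡.sym (*-distribˡ-+ 2 c a))))

subst-closed : ∀ {Π} (σ : Fin 0 → Formula Π) (φ : Formula Π) → subst σ φ ≡ φ
subst-closed σ `⊥ = refl
subst-closed σ `⊤ = refl
subst-closed σ (prop p) = refl
subst-closed σ (`¬ φ) = ≡.cong `¬ (subst-closed σ φ)
subst-closed σ (φ `∨ ψ) = ≡.cong₂ _`∨_ (subst-closed σ φ) (subst-closed σ ψ)
subst-closed σ (φ `∧ ψ) = ≡.cong₂ _`∧_ (subst-closed σ φ) (subst-closed σ ψ)
subst-closed σ (◇≥ k φ) = ≡.cong (◇≥ k) (subst-closed σ φ)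
subst-closed σ (□< k φ) = ≡.cong (□< k) (subst-closed σ φ)
subst-closed σ (⟨E⟩≥ k φ) = ≡.cong (⟨E⟩≥ k) (subst-closed σ φ)
subst-closed σ ([E]< k φ) = ≡.cong ([E]< k) (subst-closed σ φ)

sumFin-splitAt : ∀ a b (f : Fin a ⊎ Fin b → ℕ) →
  sumFin (a + b) (f ∘ splitAt a) ≡ sumFin a (f ∘ inj₁) + sumFin b (f ∘ inj₂)
sumFin-splitAt zero b f = refl
sumFin-splitAt (suc a) b f =
  ≡.trans (≡.cong (f (inj₁ zero) +_) (sumFin-splitAt a b (f ∘ map₁ suc)))
          (≡.sym (+-assoc (f (inj₁ zero)) _ _))

sumFin-mono : ∀ t {f g : Fin t → ℕ} → (∀ i → f i ≤ g i) → sumFin t f ≤ sumFin t g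
sumFin-mono zero f≤g = z≤n
sumFin-mono (suc t) f≤g = +-mono-≤ (f≤g zero) (sumFin-mono t (f≤g ∘ suc))

sumFin-distribˡ : ∀ t c (f : Fin t → ℕ) → sumFin t (λ i → c * f i) ≡ c * sumFin t f
sumFin-distribˡ zero c f = ≡.sym (*-zeroʳ c)
sumFin-distribˡ (suc t) c f =
  ≡.trans (≡.cong (c * f zero +_) (sumFin-distribˡ t c (f ∘ suc)))
          (≡.sym (*-distribˡ-+ c (f zero) _))

-- nnf¬ φ is the normal form of ¬φ; neg x is the variable standing for ¬x.
module NegationNormalForm {Π V V' : Set} (pos neg : V → V') where

  nnf nnf¬ : Schema Π V → Schema Π V'
  nnf `⊥ = `⊥
  nnf `⊤ = `⊤
  nnf (prop p) = prop p
  nnf (var x) = var (pos x)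
  nnf (`¬ φ) = nnf¬ φ
  nnf (φ `∨ ψ) = nnf φ `∨ nnf ψ
  nnf (φ `∧ ψ) = nnf φ `∧ nnf ψ
  nnf (◇≥ k φ) = ◇≥ k (nnf φ)
  nnf (□< k φ) = □< k (nnf φ)
  nnf (⟨E⟩≥ k φ) = ⟨E⟩≥ k (nnf φ)
  nnf ([E]< k φ) = [E]< k (nnf φ)
  nnf¬ `⊥ = `⊤
  nnf¬ `⊤ = `⊥
  nnf¬ (prop p) = `¬ (prop p)
  nnf¬ (var x) = var (neg x)
  nnf¬ (`¬ φ) = nnf φ
  nnf¬ (φ `∨ ψ) = nnf¬ φ `∧ nnf¬ ψ
  nnf¬ (φ `∧ ψ) = nnf¬ φ `∨ nnf¬ ψ
  nnf¬ (◇≥ k φ) = □< k (nnf¬ φ)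
  nnf¬ (□< k φ) = ◇≥ k (nnf¬ φ)
  nnf¬ (⟨E⟩≥ k φ) = [E]< k (nnf¬ φ)
  nnf¬ ([E]< k φ) = ⟨E⟩≥ k (nnf¬ φ)

  SNNF-nnf : ∀ φ → SNNF (nnf φ)
  SNNF-nnf¬ : ∀ φ → SNNF (nnf¬ φ)
  SNNF-nnf `⊥ = `⊥
  SNNF-nnf `⊤ = `⊤
  SNNF-nnf (prop p) = prop p
  SNNF-nnf (var x) = var (pos x)
  SNNF-nnf (`¬ φ) = SNNF-nnf¬ φ
  SNNF-nnf (φ `∨ ψ) = SNNF-nnf φ `∨ SNNF-nnf ψ
  SNNF-nnf (φ `∧ ψ) = SNNF-nnf φ `∧ SNNF-nnf ψ
  SNNF-nnf (◇≥ k φ) = ◇≥ k (SNNF-nnf φ)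
  SNNF-nnf (□< k φ) = □< k (SNNF-nnf φ)
  SNNF-nnf (⟨E⟩≥ k φ) = ⟨E⟩≥ k (SNNF-nnf φ)
  SNNF-nnf ([E]< k φ) = [E]< k (SNNF-nnf φ)
  SNNF-nnf¬ `⊥ = `⊤
  SNNF-nnf¬ `⊤ = `⊥
  SNNF-nnf¬ (prop p) = ¬prop p
  SNNF-nnf¬ (var x) = var (neg x)
  SNNF-nnf¬ (`¬ φ) = SNNF-nnf φ
  SNNF-nnf¬ (φ `∨ ψ) = SNNF-nnf¬ φ `∧ SNNF-nnf¬ ψ
  SNNF-nnf¬ (φ `∧ ψ) = SNNF-nnf¬ φ `∨ SNNF-nnf¬ ψ
  SNNF-nnf¬ (◇≥ k φ) = □< k (SNNF-nnf¬ φ)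
  SNNF-nnf¬ (□< k φ) = ◇≥ k (SNNF-nnf¬ φ)
  SNNF-nnf¬ (⟨E⟩≥ k φ) = [E]< k (SNNF-nnf¬ φ)
  SNNF-nnf¬ ([E]< k φ) = ⟨E⟩≥ k (SNNF-nnf¬ φ)

  size-nnf : ∀ φ → size (nnf φ) ≤ 2 * size φ
  size-nnf¬ : ∀ φ → size (nnf¬ φ) ≤ 2 * size φ
  size-nnf `⊥ = z≤n
  size-nnf `⊤ = z≤n
  size-nnf (prop p) = s≤s z≤n
  size-nnf (var x) = s≤s z≤n
  size-nnf (`¬ φ) = ≤-trans (size-nnf¬ φ) (*-monoʳ-≤ 2 (n≤1+n (size φ)))
  size-nnf (φ `∨ ψ) = +-monoʳ-≤-double 1 (size φ + size ψ) (+-mono-≤-double (size φ) (size ψ) (size-nnf φ) (size-nnf ψ))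
  size-nnf (φ `∧ ψ) = +-monoʳ-≤-double 1 (size φ + size ψ) (+-mono-≤-double (size φ) (size ψ) (size-nnf φ) (size-nnf ψ))
  size-nnf (◇≥ k φ) = +-monoʳ-≤-double (thr k) (size φ) (size-nnf φ)
  size-nnf (□< k φ) = +-monoʳ-≤-double (thr k) (size φ) (size-nnf φ)
  size-nnf (⟨E⟩≥ k φ) = +-monoʳ-≤-double (thr k) (size φ) (size-nnf φ)
  size-nnf ([E]< k φ) = +-monoʳ-≤-double (thr k) (size φ) (size-nnf φ)
  size-nnf¬ `⊥ = z≤n
  size-nnf¬ `⊤ = z≤n
  size-nnf¬ (prop p) = s≤s (s≤s z≤n)
  size-nnf¬ (var x) = s≤s z≤n
  size-nnf¬ (`¬ φ) = ≤-trans (size-nnf φ) (*-monoʳ-≤ 2 (n≤1+n (size φ)))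
  size-nnf¬ (φ `∨ ψ) = +-monoʳ-≤-double 1 (size φ + size ψ) (+-mono-≤-double (size φ) (size ψ) (size-nnf¬ φ) (size-nnf¬ ψ))
  size-nnf¬ (φ `∧ ψ) = +-monoʳ-≤-double 1 (size φ + size ψ) (+-mono-≤-double (size φ) (size ψ) (size-nnf¬ φ) (size-nnf¬ ψ))
  size-nnf¬ (◇≥ k φ) = +-monoʳ-≤-double (thr k) (size φ) (size-nnf¬ φ)
  size-nnf¬ (□< k φ) = +-monoʳ-≤-double (thr k) (size φ) (size-nnf¬ φ)
  size-nnf¬ (⟨E⟩≥ k φ) = +-monoʳ-≤-double (thr k) (size φ) (size-nnf¬ φ)
  size-nnf¬ ([E]< k φ) = +-monoʳ-≤-double (thr k) (size φ) (size-nnf¬ φ)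

  module Semantics (dne : DoubleNegationElimination 0ℓ) (M : Kripke Π)
                   (σ : V → Formula Π) (τ : V' → Formula Π)
                   (τ-pos : ∀ x w → _⊨_ M w (τ (pos x)) ⇔ _⊨_ M w (σ x))
                   (τ-neg : ∀ x w → _⊨_ M w (τ (neg x)) ⇔ (¬ _⊨_ M w (σ x))) where
    open Kripke M using (W; R)
    open Classical dne

    private
      _⊨ᴹ_ : W → Formula Π → Set
      _⊨ᴹ_ = _⊨_ M

    ⊨-nnf : ∀ φ w → w ⊨ᴹ subst τ (nnf φ) ⇔ w ⊨ᴹ subst σ φ
    ⊨-nnf¬ : ∀ φ w → w ⊨ᴹ subst τ (nnf¬ φ) ⇔ (¬ w ⊨ᴹ subst σ φ)
    ⊨-nnf `⊥ w = ⇔-id _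
    ⊨-nnf `⊤ w = ⇔-id _
    ⊨-nnf (prop p) w = ⇔-id _
    ⊨-nnf (var x) w = τ-pos x w
    ⊨-nnf (`¬ φ) w = ⊨-nnf¬ φ w
    ⊨-nnf (φ `∨ ψ) w = ⊨-nnf φ w ⊎-⇔ ⊨-nnf ψ w
    ⊨-nnf (φ `∧ ψ) w = ⊨-nnf φ w ×-⇔ ⊨-nnf ψ w
    ⊨-nnf (◇≥ k φ) w = AtLeast-cong (thr k) λ v → ⇔-id (R w v) ×-⇔ ⊨-nnf φ v
    ⊨-nnf (□< k φ) w = ¬-cong-⇔ (AtLeast-cong (thr k) λ v → ⇔-id (R w v) ×-⇔ ¬-cong-⇔ (⊨-nnf φ v))
    ⊨-nnf (⟨E⟩≥ k φ) w = AtLeast-cong (thr k) (⊨-nnf φ)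
    ⊨-nnf ([E]< k φ) w = ¬-cong-⇔ (AtLeast-cong (thr k) (¬-cong-⇔ ∘ ⊨-nnf φ))
    ⊨-nnf¬ `⊥ w = mk⇔ (λ _ ()) (λ _ → tt)
    ⊨-nnf¬ `⊤ w = mk⇔ (λ ()) (λ ¬⊤ → ⊥-elim (¬⊤ tt))
    ⊨-nnf¬ (prop p) w = ⇔-id _
    ⊨-nnf¬ (var x) w = τ-neg x w
    ⊨-nnf¬ (`¬ φ) w = ⇔-trans (⊨-nnf φ w) (⇔-sym ¬¬-⇔)
    ⊨-nnf¬ (φ `∨ ψ) w = ⇔-trans (⊨-nnf¬ φ w ×-⇔ ⊨-nnf¬ ψ w) (⇔-sym ¬-⊎-⇔)
    ⊨-nnf¬ (φ `∧ ψ) w = ⇔-trans (⊨-nnf¬ φ w ⊎-⇔ ⊨-nnf¬ ψ w) (⇔-sym ¬-×-⇔)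
    ⊨-nnf¬ (◇≥ k φ) w = ¬-cong-⇔ (AtLeast-cong (thr k) λ v →
      ⇔-id (R w v) ×-⇔ ⇔-trans (¬-cong-⇔ (⊨-nnf¬ φ v)) ¬¬-⇔)
    ⊨-nnf¬ (□< k φ) w = ⇔-trans
      (AtLeast-cong (thr k) λ v → ⇔-id (R w v) ×-⇔ ⊨-nnf¬ φ v) (⇔-sym ¬¬-⇔)
    ⊨-nnf¬ (⟨E⟩≥ k φ) w = ¬-cong-⇔ (AtLeast-cong (thr k) λ v →
      ⇔-trans (¬-cong-⇔ (⊨-nnf¬ φ v)) ¬¬-⇔)
    ⊨-nnf¬ ([E]< k φ) w = ⇔-trans (AtLeast-cong (thr k) (⊨-nnf¬ φ)) (⇔-sym ¬¬-⇔)

noVar : {A : Set} → Fin 0 → A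
noVar ()

module Closed {Π : Set} = NegationNormalForm {Π} {Fin 0} {Fin 0} noVar noVar

module _ {Π : Set} (dne : DoubleNegationElimination 0ℓ) (M : Kripke Π) where
  open Closed.Semantics {Π} dne M noVar noVar (λ ()) (λ ())

  ⊨-nnf-closed : ∀ φ w → _⊨_ M w (Closed.nnf φ) ⇔ _⊨_ M w φ
  ⊨-nnf-closed φ w =
    ≡.subst₂ (λ ψ χ → _⊨_ M w ψ ⇔ _⊨_ M w χ) (subst-closed noVar (Closed.nnf φ)) (subst-closed noVar φ) (⊨-nnf φ w)

  ⊨-nnf¬-closed : ∀ φ w → _⊨_ M w (Closed.nnf¬ φ) ⇔ (¬ _⊨_ M w φ)
  ⊨-nnf¬-closed φ w =
    ≡.subst₂ (λ ψ χ → _⊨_ M w ψ ⇔ (¬ _⊨_ M w χ)) (subst-closed noVar (Closed.nnf¬ φ)) (subst-closed noVar φ) (⊨-nnf¬ φ w)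

-- Variable i ↑ˡ t of toSNNF Λ stands for X_i and t ↑ʳ i for ¬X_i.
module _ {Π : Set} {t : ℕ} (Λ : Program Π t) where
  open Program Λ
  module Open = NegationNormalForm {Π} {Fin t} (_↑ˡ t) (t ↑ʳ_)

  signedBase : Fin t ⊎ Fin t → Formula Π
  signedBase = [ Closed.nnf ∘ base , Closed.nnf¬ ∘ base ]′

  signedInduction : Fin t ⊎ Fin t → Schema Π (Fin (t + t))
  signedInduction = [ Open.nnf ∘ induction , Open.nnf¬ ∘ induction ]′

  toSNNF : Program Π (t + t)
  toSNNF = record
    { base      = signedBase ∘ splitAt t
    ; induction = signedInduction ∘ splitAt t
    ; accepting = [ accepting , const false ]′ ∘ splitAt t
    }

  toSNNF-SNNF : ProgramSNNF toSNNF
  toSNNF-SNNF = SNNF-signedBase ∘ splitAt t , SNNF-signedInduction ∘ splitAt t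
    where
    SNNF-signedBase : ∀ s → SNNF (signedBase s)
    SNNF-signedBase (inj₁ i) = Closed.SNNF-nnf (base i)
    SNNF-signedBase (inj₂ i) = Closed.SNNF-nnf¬ (base i)
    SNNF-signedInduction : ∀ s → SNNF (signedInduction s)
    SNNF-signedInduction (inj₁ i) = Open.SNNF-nnf (induction i)
    SNNF-signedInduction (inj₂ i) = Open.SNNF-nnf¬ (induction i)

  programSize-toSNNF : programSize toSNNF ≤ 4 * programSize Λ + 4
  programSize-toSNNF = begin
    programSize toSNNF                               ≡⟨ sumFin-splitAt t t ruleSize ⟩
    sumFin t (ruleSize ∘ inj₁) + sumFin t (ruleSize ∘ inj₂)
      ≤⟨ +-mono-≤ (sumFin-mono t size-positive) (sumFin-mono t size-negative) ⟩
    sumFin t (λ i → 2 * ruleSizeΛ i) + sumFin t (λ i → 2 * ruleSizeΛ i)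
      ≡⟨ ≡.cong₂ _+_ (sumFin-distribˡ t 2 ruleSizeΛ) (sumFin-distribˡ t 2 ruleSizeΛ) ⟩
    2 * programSize Λ + 2 * programSize Λ            ≡⟨ ≡.sym (*-distribʳ-+ (programSize Λ) 2 2) ⟩
    4 * programSize Λ                                ≤⟨ m≤m+n _ 4 ⟩
    4 * programSize Λ + 4                            ∎
    where
    open Data.Nat.Properties.≤-Reasoning
    ruleSize : Fin t ⊎ Fin t → ℕ
    ruleSize s = size (signedBase s) + size (signedInduction s)
    ruleSizeΛ : Fin t → ℕ
    ruleSizeΛ i = size (base i) + size (induction i)
    size-positive : ∀ i → ruleSize (inj₁ i) ≤ 2 * ruleSizeΛ i
    size-positive i = +-mono-≤-double (size (base i)) (size (induction i)) (Closed.size-nnf (base i)) (Open.size-nnf (induction i))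
    size-negative : ∀ i → ruleSize (inj₂ i) ≤ 2 * ruleSizeΛ i
    size-negative i = +-mono-≤-double (size (base i)) (size (induction i)) (Closed.size-nnf¬ (base i)) (Open.size-nnf¬ (induction i))

  module _ (dne : DoubleNegationElimination 0ℓ) (M : Kripke Π) where
    open Kripke M using (W)

    private
      _⊨ᴹ_ : W → Formula Π → Set
      _⊨ᴹ_ = _⊨_ M

    Signed : ℕ → W → Fin t ⊎ Fin t → Set
    Signed n w = [ (λ i → w ⊨ᴹ iter Λ n i) , (λ i → ¬ w ⊨ᴹ iter Λ n i) ]′

    iter-toSNNF : ∀ n i w → w ⊨ᴹ iter toSNNF n i ⇔ Signed n w (splitAt t i)
    iter-toSNNF-↑ˡ : ∀ n i w → w ⊨ᴹ iter toSNNF n (i ↑ˡ t) ⇔ w ⊨ᴹ iter Λ n i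
    iter-toSNNF-↑ʳ : ∀ n i w → w ⊨ᴹ iter toSNNF n (t ↑ʳ i) ⇔ (¬ w ⊨ᴹ iter Λ n i)

    iter-toSNNF zero i = ⊨-signedBase (splitAt t i)
      where
      ⊨-signedBase : ∀ s w → w ⊨ᴹ signedBase s ⇔ Signed 0 w s
      ⊨-signedBase (inj₁ j) = ⊨-nnf-closed dne M (base j)
      ⊨-signedBase (inj₂ j) = ⊨-nnf¬-closed dne M (base j)
    iter-toSNNF (suc n) i = ⊨-signedInduction (splitAt t i)
      where
      open Open.Semantics dne M (iter Λ n) (iter toSNNF n) (iter-toSNNF-↑ˡ n) (iter-toSNNF-↑ʳ n)
      ⊨-signedInduction : ∀ s w → w ⊨ᴹ subst (iter toSNNF n) (signedInduction s) ⇔ Signed (suc n) w s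
      ⊨-signedInduction (inj₁ j) = ⊨-nnf (induction j)
      ⊨-signedInduction (inj₂ j) = ⊨-nnf¬ (induction j)

    iter-toSNNF-↑ˡ n i w =
      ≡.subst (λ s → w ⊨ᴹ iter toSNNF n (i ↑ˡ t) ⇔ Signed n w s) (splitAt-↑ˡ t i t) (iter-toSNNF n (i ↑ˡ t) w)
    iter-toSNNF-↑ʳ n i w =
      ≡.subst (λ s → w ⊨ᴹ iter toSNNF n (t ↑ʳ i) ⇔ Signed n w s) (splitAt-↑ʳ t t i) (iter-toSNNF n (t ↑ʳ i) w)

    Accepts-toSNNF : ∀ w → Accepts Λ M w → Accepts toSNNF M w
    Accepts-toSNNF w (n , i , accepting-i , w⊨Xᵢⁿ) =
      n , i ↑ˡ t ,
      ≡.trans (≡.cong [ accepting , const false ]′ (splitAt-↑ˡ t i t)) accepting-i ,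
      from (iter-toSNNF-↑ˡ n i w) w⊨Xᵢⁿ

    Accepts-fromSNNF : ∀ w → Accepts toSNNF M w → Accepts Λ M w
    Accepts-fromSNNF w (n , i , accepting-i , w⊨Xᵢⁿ) =
      accepted (splitAt t i) accepting-i (to (iter-toSNNF n i w) w⊨Xᵢⁿ)
      where
      accepted : ∀ s → [ accepting , const false ]′ s ≡ true → Signed n w s → Accepts Λ M w
      accepted (inj₁ j) accepting-j w⊨Xⱼⁿ = n , j , accepting-j , w⊨Xⱼⁿ
      accepted (inj₂ j) ()

toSNNF-equivalent : ∀ {Π t} → DoubleNegationElimination 0ℓ → (Λ : Program Π t) → Equivalent Λ (toSNNF Λ)
toSNNF-equivalent dne Λ M w = Accepts-toSNNF Λ dne M w , Accepts-fromSNNF Λ dne M w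

mainTheorem1 : ExcludedMiddle 0ℓ →
    Σ ℕ λ c → (Π : Set) (t : ℕ) (Λ : Program Π t) →
      Σ ℕ λ t' → Σ (Program Π t') λ Λ' →
        Equivalent Λ Λ' × ProgramSNNF Λ' × (programSize Λ' ≤ c * programSize Λ + c)
mainTheorem1 em = 4 , λ Π t Λ →
  t + t , toSNNF Λ , toSNNF-equivalent (em⇒dne em) Λ , toSNNF-SNNF Λ , programSize-toSNNF Λ
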